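{- For every integer $p\ge 2$, $$r\!\left(K_{n,n},K_{p,p},p^2-2p+2\right)=\Omega\!\left(n^{1-1/p}\right).$$
   Context: For graphs $G,H$ and an integer $q$ with $2\le q\le |E(H)|$, an $(H,q)$-coloring of $G$ is an edge-coloring of $G$ in which every subgraph of $G$ isomorphic to $H$ receives at least $q$ distinct colors; $r(G,H,q)$ is the minimum number of colors needed for $G$ to have an $(H,q)$-coloring. $K_{n,n}$, $K_{p,p}$ denote complete bipartite graphs. Asymptotic notation refers to $n\to\infty$ with $p$ fixed. -}

module Defs where

open import Data.Nat using (ℕ; _≤_)
open import Data.Fin using (Fin)
open import Data.Product using (Σ; ∃; ∃-syntax; _×_; proj₁; proj₂)
open import Relation.Binary.PropositionalEquality using (_≡_)
open import Function.Definitions using (Injective)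

-- An edge-colouring of K_{n,n} with k colours: left vertices Fin n, right
-- vertices Fin n, edge (i , j) receives colour c i j ∈ Fin k.
Coloring : ℕ → ℕ → Set
Coloring n k = Fin n → Fin n → Fin k

-- A copy of K_{p,p} in K_{n,n} is given by p distinct left vertices A and
-- p distinct right vertices B (all p² edges A×B are present).
-- "The copy receives at least q distinct colours": there are q edges of the
-- copy carrying pairwise distinct colours.
AtLeastColors : ∀ {n k} (p q : ℕ) → Coloring n k → (Fin p → Fin n) → (Fin p → Fin n) → Set
AtLeastColors p q c A B =
  Σ (Fin q → Fin p × Fin p) λ g →
    Injective _≡_ _≡_ (λ t → c (A (proj₁ (g t))) (B (proj₂ (g t))))

IsKppqColoring : ∀ {n k} (p q : ℕ) → Coloring n k → Set
IsKppqColoring {n} p q c =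
  (A B : Fin p → Fin n) → Injective _≡_ _≡_ A → Injective _≡_ _≡_ B →
  AtLeastColors p q c A B

IsR : (n p q r : ℕ) → Set
IsR n p q r =
  (Σ (Coloring n r) λ c → IsKppqColoring p q c) ×
  (∀ k → (c : Coloring n k) → IsKppqColoring p q c → r ≤ k)

-- Let c be a (K_{p,p}, p² - 2p + 2)-colouring of K_{n,n} with r colours. Split every vertex of
-- K_{n,n} into r copies, one per colour, and join the colour-k copies of a and b when the edge ab
-- has colour k: this graph has 2rn vertices and n² edges, so deleting vertices of small degree
-- leaves a subgraph of minimum degree δ ≈ n / 2r. Walks in it keep their colour, and there are
-- (δ - 1)^p non-backtracking walks of length p from a vertex. If (δ - 1)^p > 2n, two of them end
-- at the same vertex, which produces a path with a chord back into itself, and the minimum degree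
-- extends it to a path z₀, …, z₂ₚ₋₁ with a chord from z₂ₚ₋₁ to an even vertex. The even and odd
-- vertices span a K_{p,p} whose 2p path and chord edges share one colour, so it sees at most
-- p² - 2p + 1 colours, a contradiction. Hence (δ - 1)^p ≤ 2n, which gives n^{p-1} ≤ (8pr)^p.

module Submission where

open import Data.Bool using (Bool; true; false; _∧_; not; if_then_else_)
open import Data.Bool.Properties using (not-involutive; not-¬; ∧-zeroʳ) renaming (_≟_ to _≟ᵇ_)
open import Data.Empty using (⊥-elim)
open import Data.Fin
  using (Fin; zero; suc; _≟_; toℕ; fromℕ; fromℕ<; inject₁; punchIn; punchOut; splitAt; join; combine; remQuot
        ; _↑ˡ_; _↑ʳ_)
open import Data.Fin.Properties
  using ( suc-injective; toℕ-injective; toℕ<n; toℕ-inject₁; toℕ-fromℕ; toℕ-fromℕ<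
        ; inject₁-injective; fromℕ≢inject₁
        ; punchOut-injective; punchIn-punchOut; splitAt-↑ˡ; splitAt-↑ʳ; join-splitAt
        ; combine-injective; remQuot-combine; combine-remQuot; injective⇒≤; pigeonhole; any?; ¬∀⟶∃¬ )
open import Data.Nat
  using (ℕ; zero; suc; pred; _+_; _*_; _∸_; _^_; _≤_; _<_; _≤′_; ≤′-refl; ≤′-step; _≤?_; _<?_; s≤s; z≤n; NonZero; >-nonZero)
open import Data.Nat.DivMod using (_/_; m≡m%n+[m/n]*n; m%n<n; m/n*n≤m)
open import Data.Nat.Induction using (<-rec)
open import Data.Nat.Properties hiding (_≟_; suc-injective)
open import Data.Nat.Tactic.RingSolver using (solve-∀)
open import Data.Product using (Σ; ∃; ∃-syntax; _×_; _,_; proj₁; proj₂; swap)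
open import Data.Product.Properties using (,-injective)
open import Data.Sum using (_⊎_; inj₁; inj₂; [_,_]′)
open import Function using (_∘_)
open import Function.Definitions using (Injective)
open import Relation.Binary using (tri<; tri≈; tri>)
open import Relation.Binary.PropositionalEquality
open import Relation.Nullary using (¬_; Dec; yes; no; _×-dec_)
open import Relation.Nullary.Decidable using (⌊_⌋)
open import Relation.Unary using (Decidable)
open import Algebra.Properties.CommutativeMonoid.Sum +-0-commutativeMonoid
  using (sum; sum-cong-≗; ∑-distrib-+; ∑-comm; sum-replicate-zero)
open import Algebra.Properties.CommutativeSemigroup +-commutativeSemigroup using (x∙yz≈y∙xz)
open import Defs

sum-const : ∀ n c → sum {n} (λ _ → c) ≡ n * c
sum-const zero    c = refl
sum-const (suc n) c = cong (c +_) (sum-const n c)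

sum-positive : ∀ {n} (f : Fin n → ℕ) → 1 ≤ sum f → ∃ λ i → 1 ≤ f i
sum-positive {suc n} f h with f zero in eq
... | suc _ = zero , subst (1 ≤_) (sym eq) (s≤s z≤n)
... | zero  = let i , fi = sum-positive (f ∘ suc) h in suc i , fi

sum-++ : ∀ m {n} (f : Fin (m + n) → ℕ) → sum f ≡ sum (λ i → f (i ↑ˡ n)) + sum (λ j → f (m ↑ʳ j))
sum-++ zero    f = refl
sum-++ (suc m) f = trans (cong (f zero +_) (sum-++ m (f ∘ suc))) (sym (+-assoc (f zero) _ _))

sum-combine : ∀ r {n} (f : Fin (r * n) → ℕ) → sum f ≡ sum (λ k → sum (λ j → f (combine {r} {n} k j)))
sum-combine zero        f = refl
sum-combine (suc r) {n} f =
  trans (sum-++ n f) (cong (sum (λ j → f (j ↑ˡ (r * n))) +_) (sum-combine r (λ i → f (n ↑ʳ i))))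

except : ∀ {n} → Fin n → (Fin n → ℕ) → Fin n → ℕ
except v f u = if ⌊ u ≟ v ⌋ then 0 else f u

except-suc : ∀ {n} (v : Fin n) f u → except (suc v) f (suc u) ≡ except v (f ∘ suc) u
except-suc v f u with u ≟ v
... | yes refl = refl
... | no u≢v with suc u ≟ suc v
...   | yes e = ⊥-elim (u≢v (suc-injective e))
...   | no _  = refl

sum-except : ∀ {n} (f : Fin n → ℕ) v → sum f ≡ f v + sum (except v f)
sum-except f zero    = refl
sum-except f (suc v) = begin
  f zero + sum (f ∘ suc)                                   ≡⟨ cong (f zero +_) (sum-except (f ∘ suc) v) ⟩
  f zero + (f (suc v) + sum (except v (f ∘ suc)))          ≡⟨ x∙yz≈y∙xz (f zero) (f (suc v)) _ ⟩
  f (suc v) + (f zero + sum (except v (f ∘ suc)))          ≡⟨ cong (λ s → f (suc v) + (f zero + s)) (sym (sum-cong-≗ (except-suc v f))) ⟩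
  f (suc v) + sum (except (suc v) f)                       ∎
  where
  open ≡-Reasoning

sum-indicator : ∀ {n} (v : Fin n) c → sum (λ u → if ⌊ u ≟ v ⌋ then c else 0) ≡ c
sum-indicator {n} v c = begin
  sum (λ u → if ⌊ u ≟ v ⌋ then c else 0)        ≡⟨ sum-except _ v ⟩
  (if ⌊ v ≟ v ⌋ then c else 0) + sum (except v _) ≡⟨ cong₂ _+_ (at-v v) (trans (sum-cong-≗ elsewhere) (sum-replicate-zero n)) ⟩
  c + 0                                          ≡⟨ +-identityʳ c ⟩
  c                                              ∎
  where
  open ≡-Reasoning
  at-v : ∀ v → (if ⌊ v ≟ v ⌋ then c else 0) ≡ c
  at-v v with v ≟ v
  ... | yes _   = refl
  ... | no v≢v  = ⊥-elim (v≢v refl)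
  elsewhere : ∀ u → except v (λ u → if ⌊ u ≟ v ⌋ then c else 0) u ≡ 0
  elsewhere u with ⌊ u ≟ v ⌋
  ... | true  = refl
  ... | false = refl

∧-true : ∀ {b b′} → b ∧ b′ ≡ true → b ≡ true × b′ ≡ true
∧-true {true} {true} _ = refl , refl

injective-≗ : ∀ {A B : Set} {f g : A → B} → (∀ x → f x ≡ g x) → Injective _≡_ _≡_ g → Injective _≡_ _≡_ f
injective-≗ f≗g g-inj {x} {y} e = g-inj (trans (sym (f≗g x)) (trans e (f≗g y)))

𝟙 : Bool → ℕ
𝟙 b = if b then 1 else 0

count : ∀ {n} → (Fin n → Bool) → ℕ
count f = sum (𝟙 ∘ f)

≤count⇒injection : ∀ {n} (f : Fin n → Bool) m → m ≤ count f →
  Σ (Fin m → Fin n) λ h → Injective _≡_ _≡_ h × (∀ i → f (h i) ≡ true)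
≤count⇒injection f       zero    _ = (λ ()) , (λ {}) , λ ()
≤count⇒injection {suc n} f (suc m) m<count with f zero in f0
... | false = let h , h-inj , fh = ≤count⇒injection (f ∘ suc) (suc m) m<count
              in suc ∘ h , h-inj ∘ suc-injective , fh
... | true  = let h , h-inj , fh = ≤count⇒injection (f ∘ suc) m (≤-pred m<count)
              in extend h , extend-injective h-inj , extend-true fh
  where
  extend : (Fin m → Fin n) → Fin (suc m) → Fin (suc n)
  extend h zero    = zero
  extend h (suc i) = suc (h i)
  extend-injective : ∀ {h} → Injective _≡_ _≡_ h → Injective _≡_ _≡_ (extend h)
  extend-injective h-inj {zero}  {zero}  _ = refl
  extend-injective h-inj {suc i} {suc j} e = cong suc (h-inj (suc-injective e))
  extend-true : ∀ {h} → (∀ i → f (suc (h i)) ≡ true) → ∀ i → f (extend h i) ≡ true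
  extend-true fh zero    = f0
  extend-true fh (suc i) = fh i

sum-select : ∀ {r n} (v : Fin r) (g : Fin n → ℕ) → sum (λ k → sum (λ s → if ⌊ k ≟ v ⌋ then g s else 0)) ≡ sum g
sum-select {n = n} v g = trans (sum-cong-≗ pull-out) (sum-indicator v (sum g))
  where
  pull-out : ∀ k → sum (λ s → if ⌊ k ≟ v ⌋ then g s else 0) ≡ (if ⌊ k ≟ v ⌋ then sum g else 0)
  pull-out k with ⌊ k ≟ v ⌋
  ... | true  = refl
  ... | false = sum-replicate-zero n

least : ∀ {P : ℕ → Set} → Decidable P → ∀ n → P n →
  ∃ λ b → b ≤ n × P b × (∀ b′ → b′ < b → ¬ P b′)
least {P} P? = <-rec Goal go
  where
  Goal : ℕ → Set
  Goal n = P n → ∃ λ b → b ≤ n × P b × (∀ b′ → b′ < b → ¬ P b′)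
  go : ∀ n → (∀ {m} → m < n → Goal m) → Goal n
  go n rec Pn with anyUpTo? P? n
  ... | no none = n , ≤-refl , Pn , λ b′ b′<n Pb′ → none (b′ , b′<n , Pb′)
  ... | yes (m , m<n , Pm) =
    let b , b≤m , Pb , minimal = rec m<n Pm in b , ≤-trans b≤m (<⇒≤ m<n) , Pb , minimal

-- The i-th of the m ^ p sequences of length p over Fin m, padded with a default value.
sequence : ∀ {m} → Fin m → ∀ p → Fin (m ^ p) → ℕ → Fin m
sequence     default zero    i j       = default
sequence {m} default (suc p) i zero    = proj₁ (remQuot {m} (m ^ p) i)
sequence {m} default (suc p) i (suc j) = sequence default p (proj₂ (remQuot {m} (m ^ p) i)) j

first-difference : ∀ {m} (default : Fin m) p {i i′ : Fin (m ^ p)} → i ≢ i′ →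
  ∃ λ d → d < p × (∀ {j} → j < d → sequence default p i j ≡ sequence default p i′ j)
                × sequence default p i d ≢ sequence default p i′ d
first-difference default zero    {zero} {zero} i≢i′ = ⊥-elim (i≢i′ refl)
first-difference {m} default (suc p) {i} {i′} i≢i′
  with proj₁ (remQuot {m} (m ^ p) i) ≟ proj₁ (remQuot {m} (m ^ p) i′)
... | no heads-differ = zero , s≤s z≤n , (λ ()) , heads-differ
... | yes heads-agree with first-difference default p tails-differ
  where
  tails-differ : proj₂ (remQuot {m} (m ^ p) i) ≢ proj₂ (remQuot {m} (m ^ p) i′)
  tails-differ e = i≢i′ (trans (sym (combine-remQuot {m} (m ^ p) i))
    (trans (cong₂ combine heads-agree e) (combine-remQuot {m} (m ^ p) i′)))
... | d , d<p , agree , differ = suc d , s≤s d<p , agree′ , differ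
  where
  agree′ : ∀ {j} → j < suc d → sequence default (suc p) i j ≡ sequence default (suc p) i′ j
  agree′ {zero}  _         = heads-agree
  agree′ {suc j} (s≤s j<d) = agree j<d

no-D+1-distinct-values : ∀ {C : Set} K D (κ : Fin (K + D) → C) (σ : Fin (suc K) → Fin (K + D)) →
  Injective _≡_ _≡_ σ → (∀ i j → κ (σ i) ≡ κ (σ j)) →
  (g : Fin (suc D) → Fin (K + D)) → ¬ Injective _≡_ _≡_ (κ ∘ g)
no-D+1-distinct-values zero    D κ σ σ-inj κσ g κg-inj = <-irrefl refl (injective⇒≤ (κg-inj ∘ cong κ))
no-D+1-distinct-values (suc K) D κ σ σ-inj κσ g κg-inj =
  no-D+1-distinct-values K D (κ ∘ punchIn s₀) σ′ σ′-injective κσ′ (redirect ∘ g) (injective-≗ (κ-redirect ∘ g) κg-inj)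
  where
  s₀ = σ zero
  s₀≢σ-suc : ∀ i → s₀ ≢ σ (suc i)
  s₀≢σ-suc i e with σ-inj e
  ... | ()
  σ′ : Fin (suc K) → Fin (K + D)
  σ′ i = punchOut (s₀≢σ-suc i)
  σ′-injective : Injective _≡_ _≡_ σ′
  σ′-injective e = suc-injective (σ-inj (punchOut-injective (s₀≢σ-suc _) (s₀≢σ-suc _) e))
  κσ′ : ∀ i j → κ (punchIn s₀ (σ′ i)) ≡ κ (punchIn s₀ (σ′ j))
  κσ′ i j = trans (cong κ (punchIn-punchOut _)) (trans (κσ (suc i) (suc j)) (cong κ (sym (punchIn-punchOut _))))
  -- Drop the point s₀ = σ 0: g is redirected from s₀ to σ 1, which has the same κ-value.
  redirect : Fin (suc (K + D)) → Fin (K + D)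
  redirect x with s₀ ≟ x
  ... | yes _    = σ′ zero
  ... | no s₀≢x = punchOut s₀≢x
  κ-redirect : ∀ x → κ (punchIn s₀ (redirect x)) ≡ κ x
  κ-redirect x with s₀ ≟ x
  ... | yes refl = trans (cong κ (punchIn-punchOut _)) (κσ (suc zero) zero)
  ... | no s₀≢x  = cong κ (punchIn-punchOut s₀≢x)

suc≢inject₁ : ∀ {n} (j : Fin n) → suc j ≢ inject₁ j
suc≢inject₁ j e = 1+n≢n (trans (cong toℕ e) (toℕ-inject₁ j))

module _ (p₂ : ℕ) where
  private
    p₁ p : ℕ
    p₁ = suc p₂
    p  = suc p₁

  Pos : Set
  Pos = Fin p × Fin p

  private
    edge : Fin p ⊎ Fin p₁ → Pos
    edge = [ (λ j → j , j) , (λ j → suc j , inject₁ j) ]′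

    edge-injective : Injective _≡_ _≡_ edge
    edge-injective {inj₁ i} {inj₁ j} e = cong inj₁ (proj₁ (,-injective e))
    edge-injective {inj₂ i} {inj₂ j} e = cong inj₂ (suc-injective (proj₁ (,-injective e)))
    edge-injective {inj₁ i} {inj₂ j} e = let e₁ , e₂ = ,-injective e in ⊥-elim (suc≢inject₁ j (trans (sym e₁) e₂))
    edge-injective {inj₂ i} {inj₁ j} e = let e₁ , e₂ = ,-injective e in ⊥-elim (suc≢inject₁ i (trans e₁ (sym e₂)))

    edge≢chord : ∀ t x → edge x ≢ (inject₁ t , fromℕ p₁)
    edge≢chord t (inj₁ j) e = let e₁ , e₂ = ,-injective e in fromℕ≢inject₁ (trans (sym e₂) e₁)
    edge≢chord t (inj₂ j) e = fromℕ≢inject₁ (sym (proj₂ (,-injective e)))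

  -- The 2p positions (j , j), (j + 1 , j) and (t , p - 1): a Hamiltonian path of K_{p,p}
  -- and a chord back from its last vertex.
  path-and-chord : Fin p₁ → Fin (suc (p + p₁)) → Pos
  path-and-chord t zero    = inject₁ t , fromℕ p₁
  path-and-chord t (suc l) = edge (splitAt p l)

  path-and-chord-injective : ∀ t → Injective _≡_ _≡_ (path-and-chord t)
  path-and-chord-injective t {zero}  {zero}  e = refl
  path-and-chord-injective t {zero}  {suc l} e = ⊥-elim (edge≢chord t (splitAt p l) (sym e))
  path-and-chord-injective t {suc l} {zero}  e = ⊥-elim (edge≢chord t (splitAt p l) e)
  path-and-chord-injective t {suc l} {suc m} e =
    cong suc (trans (sym (join-splitAt p p₁ l))
      (trans (cong (join p p₁) (edge-injective {splitAt p l} {splitAt p m} e)) (join-splitAt p p₁ m)))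

  private
    2p≤p*p : 2 * p ≤ p * p
    2p≤p*p = *-monoˡ-≤ p {2} {p} (s≤s (s≤s z≤n))

    p*p≡path+rest : p * p ≡ (p + p₁) + suc (p * p ∸ 2 * p)
    p*p≡path+rest = sym (begin
      (p + p₁) + suc (p * p ∸ 2 * p) ≡⟨ +-suc (p + p₁) _ ⟩
      suc (p + p₁) + (p * p ∸ 2 * p) ≡⟨ cong (_+ (p * p ∸ 2 * p)) (trans (sym (+-suc p p₁)) (cong (p +_) (sym (+-identityʳ p)))) ⟩
      2 * p + (p * p ∸ 2 * p)        ≡⟨ m+[n∸m]≡n 2p≤p*p ⟩
      p * p                          ∎)
      where open ≡-Reasoning

  path-and-chord-monochromatic⇒few-colours : ∀ {C : Set} (κ : Pos → C) (c₀ : C) (t : Fin p₁) →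
    (∀ j → κ (j , j) ≡ c₀) → (∀ j → κ (suc j , inject₁ j) ≡ c₀) → κ (inject₁ t , fromℕ p₁) ≡ c₀ →
    (g : Fin (p * p ∸ 2 * p + 2) → Pos) → ¬ Injective _≡_ _≡_ (κ ∘ g)
  path-and-chord-monochromatic⇒few-colours {C} κ c₀ t diagonal subdiagonal chord g κg-inj =
    few-values p*p≡path+rest (+-comm (p * p ∸ 2 * p) 2) (κ ∘ decode) (encode ∘ path-and-chord t)
      (path-and-chord-injective t ∘ encode-injective) κ-constant (encode ∘ g)
      (injective-≗ (λ x → cong κ (decode-encode (g x))) κg-inj)
    where
    encode : Pos → Fin (p * p)
    encode (i , j) = combine i j
    decode : Fin (p * p) → Pos
    decode = remQuot p
    decode-encode : ∀ x → decode (encode x) ≡ x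
    decode-encode (i , j) = remQuot-combine i j
    encode-injective : Injective _≡_ _≡_ encode
    encode-injective {i , j} {k , l} e with combine-injective i j k l e
    ... | refl , refl = refl
    κ-path-and-chord : ∀ l → κ (path-and-chord t l) ≡ c₀
    κ-path-and-chord zero = chord
    κ-path-and-chord (suc l) with splitAt p l
    ... | inj₁ j = diagonal j
    ... | inj₂ j = subdiagonal j
    κ-constant : ∀ l m → κ (decode (encode (path-and-chord t l))) ≡ κ (decode (encode (path-and-chord t m)))
    κ-constant l m = trans (cong κ (decode-encode _)) (trans (κ-path-and-chord l)
      (sym (trans (cong κ (decode-encode _)) (κ-path-and-chord m))))
    few-values : ∀ {P K D Q} → P ≡ K + D → Q ≡ suc D →
      (κ : Fin P → C) (σ : Fin (suc K) → Fin P) → Injective _≡_ _≡_ σ → (∀ i j → κ (σ i) ≡ κ (σ j)) →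
      (g : Fin Q → Fin P) → ¬ Injective _≡_ _≡_ (κ ∘ g)
    few-values refl refl = no-D+1-distinct-values _ _

module MinDegree {N : ℕ} (adj : Fin N → Fin N → Bool)
  (adj-sym : ∀ u v → adj u v ≡ adj v u) (adj-irrefl : ∀ u → adj u u ≡ false) where

  degree : (Fin N → Bool) → Fin N → ℕ
  degree K w = count (λ u → K u ∧ adj w u)

  degree-sum : (Fin N → Bool) → ℕ
  degree-sum K = sum (λ w → if K w then degree K w else 0)

  _-_ : (Fin N → Bool) → Fin N → Fin N → Bool
  (K - v) u = if ⌊ u ≟ v ⌋ then false else K u

  HasMinDegree : ℕ → (Fin N → Bool) → Set
  HasMinDegree δ K = ∀ v → K v ≡ true → δ ≤ degree K v

  module _ (K : Fin N → Bool) (v : Fin N) (Kv : K v ≡ true) where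

    count-remove : count K ≡ suc (count (K - v))
    count-remove = trans (sum-except (𝟙 ∘ K) v) (cong₂ _+_ (cong 𝟙 Kv) (sum-cong-≗ pointwise))
      where
      pointwise : ∀ u → except v (𝟙 ∘ K) u ≡ 𝟙 ((K - v) u)
      pointwise u with ⌊ u ≟ v ⌋
      ... | true  = refl
      ... | false = refl

    degree-remove : ∀ w → degree K w ≡ 𝟙 (adj w v) + degree (K - v) w
    degree-remove w = trans (sum-except _ v) (cong₂ _+_ (cong (λ b → 𝟙 (b ∧ adj w v)) Kv) (sum-cong-≗ pointwise))
      where
      pointwise : ∀ u → except v (λ u → 𝟙 (K u ∧ adj w u)) u ≡ 𝟙 ((K - v) u ∧ adj w u)
      pointwise u with ⌊ u ≟ v ⌋
      ... | true  = refl
      ... | false = refl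

    -- Each edge at v is counted at v and again at its other end.
    degree-from-rest : sum (λ w → if (K - v) w then 𝟙 (adj w v) else 0) ≡ degree K v
    degree-from-rest = sym (trans (sum-except _ v) (cong₂ _+_ no-loop (sum-cong-≗ pointwise)))
      where
      no-loop : 𝟙 (K v ∧ adj v v) ≡ 0
      no-loop rewrite adj-irrefl v = cong 𝟙 (∧-zeroʳ (K v))
      pointwise : ∀ u → except v (λ u → 𝟙 (K u ∧ adj v u)) u ≡ (if (K - v) u then 𝟙 (adj u v) else 0)
      pointwise u rewrite adj-sym v u with ⌊ u ≟ v ⌋ | K u
      ... | true  | _     = refl
      ... | false | true  = refl
      ... | false | false = refl

    degree-sum-remove : degree-sum K ≡ degree K v + (degree K v + degree-sum (K - v))
    degree-sum-remove = begin
      degree-sum K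
        ≡⟨ sum-except _ v ⟩
      (if K v then degree K v else 0) + sum (except v (λ w → if K w then degree K w else 0))
        ≡⟨ cong₂ _+_ (cong (λ b → if b then degree K v else 0) Kv) (sum-cong-≗ pointwise) ⟩
      degree K v + sum (λ w → towards-v w + rest w)
        ≡⟨ cong (degree K v +_) (∑-distrib-+ towards-v rest) ⟩
      degree K v + (sum towards-v + degree-sum (K - v))
        ≡⟨ cong (λ d → degree K v + (d + degree-sum (K - v))) degree-from-rest ⟩
      degree K v + (degree K v + degree-sum (K - v)) ∎
      where
      open ≡-Reasoning
      towards-v rest : Fin N → ℕ
      towards-v w = if (K - v) w then 𝟙 (adj w v) else 0
      rest      w = if (K - v) w then degree (K - v) w else 0
      pointwise : ∀ w → except v (λ w → if K w then degree K w else 0) w ≡ towards-v w + rest w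
      pointwise w with ⌊ w ≟ v ⌋ | K w
      ... | true  | _     = refl
      ... | false | true  = degree-remove w
      ... | false | false = refl

  private
    remove-low-degree : ∀ δ s d t → 2 * (δ * suc s) < d + (d + t) → d < δ → 2 * (δ * s) < t
    remove-low-degree δ s d t h d<δ = +-cancelˡ-< (2 * δ) _ _ (begin-strict
      2 * δ + 2 * (δ * s) ≡⟨ distrib δ s ⟩
      2 * (δ * suc s)     <⟨ h ⟩
      d + (d + t)         ≡⟨ sym (+-assoc d d t) ⟩
      (d + d) + t         ≤⟨ +-monoˡ-≤ t (+-mono-≤ (<⇒≤ d<δ) (<⇒≤ d<δ)) ⟩
      (δ + δ) + t         ≡⟨ cong (_+ t) (cong (δ +_) (sym (+-identityʳ δ))) ⟩
      2 * δ + t           ∎)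
      where
      open ≤-Reasoning
      distrib : ∀ δ s → 2 * δ + 2 * (δ * s) ≡ 2 * (δ * suc s)
      distrib = solve-∀

  min-degree-subgraph : ∀ δ K → 2 * (δ * count K) < degree-sum K →
    ∃ λ K′ → (∃ λ v → K′ v ≡ true) × HasMinDegree δ K′
  min-degree-subgraph δ K = go (count K) K refl
    where
    go : ∀ s K → count K ≡ s → 2 * (δ * s) < degree-sum K → ∃ λ K′ → (∃ λ v → K′ v ≡ true) × HasMinDegree δ K′
    go s K size dense with any? (λ v → (K v ≟ᵇ true) ×-dec (degree K v <? δ))
    ... | no none = K , nonempty , λ v Kv → ≮⇒≥ (λ low → none (v , Kv , low))
      where
      nonempty : ∃ λ v → K v ≡ true
      nonempty with sum-positive _ (≤-trans (s≤s z≤n) dense)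
      ... | w , positive with K w in Kw
      ...   | true = w , Kw
    go zero    K size dense | yes (v , Kv , low) = ⊥-elim (1+n≢0 (trans (sym (count-remove K v Kv)) size))
    go (suc s) K size dense | yes (v , Kv , low) =
      go s (K - v) (cong pred (trans (sym (count-remove K v Kv)) size))
        (remove-low-degree δ s _ _ (subst (2 * (δ * suc s) <_) (degree-sum-remove K v Kv) dense) low)

∸-suc : ∀ {n i} → suc i ≤ n → n ∸ i ≡ suc (n ∸ suc i)
∸-suc {suc n} {zero}  _         = refl
∸-suc {suc n} {suc i} (s≤s i<n) = ∸-suc i<n

module Walks {N : ℕ} (adj : Fin N → Fin N → Bool)
  (adj-sym : ∀ u v → adj u v ≡ adj v u) (adj-irrefl : ∀ u → adj u u ≡ false)
  (K : Fin N → Bool) where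

  infix 4 _~_
  _~_ : Fin N → Fin N → Set
  u ~ v = adj u v ≡ true

  ~-sym : ∀ {u v} → u ~ v → v ~ u
  ~-sym {u} {v} u~v = trans (adj-sym v u) u~v

  ~-irrefl : ∀ {u v} → u ~ v → u ≢ v
  ~-irrefl {u} u~u refl with trans (sym u~u) (adj-irrefl u)
  ... | ()

  record NonBacktracking (W : ℕ → Fin N) (len : ℕ) : Set where
    field
      step      : ∀ {i} → i < len → W i ~ W (suc i)
      no-return : ∀ {i} → 2 + i ≤ len → W (2 + i) ≢ W i
      inside    : ∀ {i} → i ≤ len → K (W i) ≡ true

  record Lollipop (L : ℕ) : Set where
    field
      vertex     : ℕ → Fin N
      anchor     : ℕ
      distinct   : ∀ {i j} → i ≤ L → j ≤ L → vertex i ≡ vertex j → i ≡ j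
      path       : ∀ {i} → i < L → vertex i ~ vertex (suc i)
      chord      : vertex L ~ vertex anchor
      anchor+2≤L : 2 + anchor ≤ L
      inside     : ∀ {i} → i ≤ L → K (vertex i) ≡ true

  -- The first repetition of a non-backtracking walk closes a cycle of length at least 3.
  lollipop-from-repeat : ∀ {W len a b} → NonBacktracking W len → a < b → b ≤ len → W a ≡ W b →
    ∃ λ L → L < b × Lollipop L
  lollipop-from-repeat {W} {len} {a} {b} walk a<b b≤len Wa≡Wb
    with least (λ b → anyUpTo? (λ a → W a ≟ W b) b) b (a , a<b , Wa≡Wb)
  ... | suc L , L<b , (a′ , s≤s a′≤L , Wa′≡W1+L) , first = L , L<b , record
    { vertex     = W
    ; anchor     = a′
    ; distinct   = distinct
    ; path       = λ i<L → step (<-trans i<L L<len)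
    ; chord      = subst (W L ~_) (sym Wa′≡W1+L) (step L<len)
    ; anchor+2≤L = anchor+2≤L
    ; inside     = λ i≤L → inside (≤-trans i≤L (<⇒≤ L<len))
    }
    where
    open NonBacktracking walk
    L<len : L < len
    L<len = ≤-trans L<b b≤len
    distinct : ∀ {i j} → i ≤ L → j ≤ L → W i ≡ W j → i ≡ j
    distinct {i} {j} i≤L j≤L Wi≡Wj with <-cmp i j
    ... | tri< i<j _ _ = ⊥-elim (first j (s≤s j≤L) (i , i<j , Wi≡Wj))
    ... | tri≈ _ i≡j _ = i≡j
    ... | tri> _ _ j<i = ⊥-elim (first i (s≤s i≤L) (j , j<i , sym Wi≡Wj))
    anchor+2≤L : 2 + a′ ≤ L
    anchor+2≤L with m≤n⇒m<n∨m≡n a′≤L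
    ... | inj₂ refl = ⊥-elim (~-irrefl (step L<len) Wa′≡W1+L)
    ... | inj₁ a′<L with m≤n⇒m<n∨m≡n a′<L
    ...   | inj₁ a′+1<L = a′+1<L
    ...   | inj₂ refl   = ⊥-elim (no-return (≤-trans L<b b≤len) (sym Wa′≡W1+L))

  -- X 0, …, X e = Y e, Y (e - 1), …, Y 0; it does not backtrack at the turn since X and Y
  -- differ just before e.
  module Glue {X Y : ℕ → Fin N} {p e : ℕ} (walkX : NonBacktracking X p) (walkY : NonBacktracking Y p)
    (e≤p : e ≤ p) (meet : X e ≡ Y e) (turn : ∀ {i} → suc i ≡ e → X i ≢ Y i) where

    private
      module X = NonBacktracking walkX
      module Y = NonBacktracking walkY

    R : ℕ → Fin N
    R i with i ≤? e
    ... | yes _ = X i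
    ... | no  _ = Y (e + e ∸ i)

    R-left : ∀ {i} → i ≤ e → R i ≡ X i
    R-left {i} i≤e with i ≤? e
    ... | yes _   = refl
    ... | no  i≰e = ⊥-elim (i≰e i≤e)

    R-right : ∀ {i} → e ≤ i → R i ≡ Y (e + e ∸ i)
    R-right {i} e≤i with i ≤? e
    ... | no  _   = refl
    ... | yes i≤e with ≤-antisym i≤e e≤i
    ...   | refl  = trans meet (cong Y (sym (m+n∸n≡m e e)))

    private
      back≤e : ∀ {i} → e ≤ i → e + e ∸ i ≤ e
      back≤e e≤i = ≤-trans (∸-monoʳ-≤ (e + e) e≤i) (≤-reflexive (m+n∸n≡m e e))

      step : ∀ {i} → i < e + e → R i ~ R (suc i)
      step {i} i<e+e = by-cases (suc i ≤? e)
        where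
        by-cases : Dec (suc i ≤ e) → R i ~ R (suc i)
        by-cases (yes i<e) = subst₂ _~_ (sym (R-left (<⇒≤ i<e))) (sym (R-left i<e)) (X.step (≤-trans i<e e≤p))
        by-cases (no  i≮e) =
          subst₂ _~_ (sym (trans (R-right e≤i) (cong Y (∸-suc i<e+e)))) (sym (R-right (≤-trans e≤i (n≤1+n i))))
            (~-sym (Y.step (≤-trans (≤-trans (≤-reflexive (sym (∸-suc i<e+e))) (back≤e e≤i)) e≤p)))
          where
          e≤i : e ≤ i
          e≤i = ≤-pred (≰⇒> i≮e)

      no-return : ∀ {i} → 2 + i ≤ e + e → R (2 + i) ≢ R i
      no-return {i} 2+i≤e+e = by-cases (2 + i ≤? e) (e ≤? i)
        where
        by-cases : Dec (2 + i ≤ e) → Dec (e ≤ i) → R (2 + i) ≢ R i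
        by-cases (yes 2+i≤e) _ =
          subst₂ _≢_ (sym (R-left 2+i≤e)) (sym (R-left (≤-trans (n≤1+n i) (≤-trans (n≤1+n (suc i)) 2+i≤e))))
            (X.no-return (≤-trans 2+i≤e e≤p))
        by-cases (no _) (yes e≤i) =
          subst₂ _≢_ (sym (R-right (≤-trans e≤i (≤-trans (n≤1+n i) (n≤1+n (suc i)))))) (sym (R-right e≤i))
            (λ e′ → Y.no-return 2+j≤p (trans (cong Y (sym back-shift)) (sym e′)))
          where
          back-shift : e + e ∸ i ≡ 2 + (e + e ∸ (2 + i))
          back-shift = trans (∸-suc (≤-trans (n≤1+n (suc i)) 2+i≤e+e)) (cong suc (∸-suc 2+i≤e+e))
          2+j≤p : 2 + (e + e ∸ (2 + i)) ≤ p
          2+j≤p = ≤-trans (≤-reflexive (sym back-shift)) (≤-trans (back≤e e≤i) e≤p)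
        by-cases (no 2+i≰e) (no e≰i) with ≤-antisym (≤-pred (≰⇒> 2+i≰e)) (≰⇒> e≰i)
        ... | refl = subst₂ _≢_ (sym (trans (R-right (n≤1+n e)) (cong Y (m+n∸n≡m i (suc i))))) (sym (R-left (n≤1+n i)))
                       (λ Yi≡Xi → turn refl (sym Yi≡Xi))

      inside : ∀ {i} → i ≤ e + e → K (R i) ≡ true
      inside {i} _ with i ≤? e
      ... | yes i≤e = X.inside (≤-trans i≤e e≤p)
      ... | no  i≰e = Y.inside (≤-trans (back≤e (<⇒≤ (≰⇒> i≰e))) e≤p)

    glued : NonBacktracking R (e + e)
    glued = record { step = step ; no-return = no-return ; inside = inside }

  -- Glue the two walks at their first meeting point after the fork.
  lollipop-from-fork : ∀ {X Y p d} → NonBacktracking X p → NonBacktracking Y p →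
    (∀ {i} → i ≤ d → X i ≡ Y i) → X (suc d) ≢ Y (suc d) → d < p → X p ≡ Y p →
    ∃ λ L → L < p + p × Lollipop L
  lollipop-from-fork {X} {Y} {p} {d} walkX walkY common fork d<p meet
    with least (λ e → (d <? e) ×-dec (X e ≟ Y e)) p (d<p , meet)
  ... | e , e≤p , (d<e , Xe≡Ye) , first =
    let L , L<e+e , lollipop = lollipop-from-repeat glued (≤-trans (s≤s z≤n) (≤-trans d<e (m≤m+n e e))) ≤-refl closed
    in L , ≤-trans L<e+e (+-mono-≤ e≤p e≤p) , lollipop
    where
    d+2≤e : 2 + d ≤ e
    d+2≤e with m≤n⇒m<n∨m≡n d<e
    ... | inj₁ d+1<e = d+1<e
    ... | inj₂ refl  = ⊥-elim (fork Xe≡Ye)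
    turn : ∀ {i} → suc i ≡ e → X i ≢ Y i
    turn {i} refl Xi≡Yi = first i ≤-refl (≤-pred d+2≤e , Xi≡Yi)
    open Glue walkX walkY e≤p Xe≡Ye turn
    closed : R 0 ≡ R (e + e)
    closed = trans (R-left z≤n) (trans (common z≤n) (trans (cong Y (sym (n∸n≡0 (e + e)))) (sym (R-right (m≤m+n e e)))))

  module _ {m : ℕ} (nbr : Fin N → Fin (suc m) → Fin N)
    (nbr-injective : ∀ {v} → K v ≡ true → Injective _≡_ _≡_ (nbr v))
    (nbr-inside    : ∀ {v} i → K v ≡ true → K (nbr v i) ≡ true)
    (nbr-adjacent  : ∀ {v} i → K v ≡ true → v ~ nbr v i) where

    -- Of its m + 1 neighbours, vertex 0 has one off the path of L + 1 ≤ m vertices.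
    prepend : ∀ {L} → L < m → Lollipop L → Lollipop (suc L)
    prepend {L} L<m lollipop = record
      { vertex     = vertex′
      ; anchor     = suc anchor
      ; distinct   = distinct′
      ; path       = path′
      ; chord      = chord
      ; anchor+2≤L = s≤s anchor+2≤L
      ; inside     = inside′
      }
      where
      open Lollipop lollipop
      z₀ = vertex 0
      K-z₀ = inside z≤n
      OnPath : Fin (suc m) → Set
      OnPath i = ∃ λ l → l < suc L × vertex l ≡ nbr z₀ i
      not-all-on-path : ¬ (∀ i → OnPath i)
      not-all-on-path all = <-irrefl refl (≤-trans (s≤s L<m) (injective⇒≤ position-injective))
        where
        position : Fin (suc m) → Fin (suc L)
        position i = fromℕ< (proj₁ (proj₂ (all i)))
        position-injective : Injective _≡_ _≡_ position
        position-injective {i} {j} e = nbr-injective K-z₀ (trans (sym (proj₂ (proj₂ (all i))))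
          (trans (cong vertex (trans (sym (toℕ-fromℕ< _)) (trans (cong toℕ e) (toℕ-fromℕ< _)))) (proj₂ (proj₂ (all j)))))
      fresh : ∃ λ i → ¬ OnPath i
      fresh = ¬∀⟶∃¬ _ OnPath (λ i → anyUpTo? (λ l → vertex l ≟ nbr z₀ i) (suc L)) not-all-on-path
      vertex′ : ℕ → Fin N
      vertex′ zero    = nbr z₀ (proj₁ fresh)
      vertex′ (suc l) = vertex l
      distinct′ : ∀ {i j} → i ≤ suc L → j ≤ suc L → vertex′ i ≡ vertex′ j → i ≡ j
      distinct′ {zero}  {zero}  _         _         _ = refl
      distinct′ {zero}  {suc j} _         (s≤s j≤L) e = ⊥-elim (proj₂ fresh (j , s≤s j≤L , sym e))
      distinct′ {suc i} {zero}  (s≤s i≤L) _         e = ⊥-elim (proj₂ fresh (i , s≤s i≤L , e))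
      distinct′ {suc i} {suc j} (s≤s i≤L) (s≤s j≤L) e = cong suc (distinct i≤L j≤L e)
      path′ : ∀ {i} → i < suc L → vertex′ i ~ vertex′ (suc i)
      path′ {zero}  _         = ~-sym (nbr-adjacent _ K-z₀)
      path′ {suc i} (s≤s i<L) = path i<L
      inside′ : ∀ {i} → i ≤ suc L → K (vertex′ i) ≡ true
      inside′ {zero}  _         = nbr-inside _ K-z₀
      inside′ {suc i} (s≤s i≤L) = inside i≤L

    grow : ∀ {L L′} → L ≤′ L′ → L′ ≤ m → Lollipop L → Lollipop L′
    grow ≤′-refl       _    lollipop = lollipop
    grow (≤′-step L≤L′) L′<m lollipop = prepend L′<m (grow L≤L′ (<⇒≤ L′<m) lollipop)

    -- The k-th neighbour of cur, skipping prev: nbr cur (fromℕ m) takes the place of prev.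
    step : Fin N → Fin N → Fin m → Fin N
    step prev cur k with nbr cur (inject₁ k) ≟ prev
    ... | yes _ = nbr cur (fromℕ m)
    ... | no  _ = nbr cur (inject₁ k)

    module _ (prev : Fin N) {cur : Fin N} (K-cur : K cur ≡ true) where

      step-inside : ∀ k → K (step prev cur k) ≡ true
      step-inside k with nbr cur (inject₁ k) ≟ prev
      ... | yes _ = nbr-inside _ K-cur
      ... | no  _ = nbr-inside _ K-cur

      step-adjacent : ∀ k → cur ~ step prev cur k
      step-adjacent k with nbr cur (inject₁ k) ≟ prev
      ... | yes _ = nbr-adjacent _ K-cur
      ... | no  _ = nbr-adjacent _ K-cur

      step-no-return : ∀ k → step prev cur k ≢ prev
      step-no-return k with nbr cur (inject₁ k) ≟ prev
      ... | yes e = λ e′ → fromℕ≢inject₁ (nbr-injective K-cur (trans e′ (sym e)))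
      ... | no ne = ne

      step-injective : Injective _≡_ _≡_ (step prev cur)
      step-injective {k} {k′} e with nbr cur (inject₁ k) ≟ prev | nbr cur (inject₁ k′) ≟ prev
      ... | yes a | yes b = inject₁-injective (nbr-injective K-cur (trans a (sym b)))
      ... | yes _ | no  _ = ⊥-elim (fromℕ≢inject₁ (nbr-injective K-cur e))
      ... | no  _ | yes _ = ⊥-elim (fromℕ≢inject₁ (nbr-injective K-cur (sym e)))
      ... | no  _ | no  _ = inject₁-injective (nbr-injective K-cur e)

    walk previous : Fin N → (ℕ → Fin m) → ℕ → Fin N
    walk x choice zero    = x
    walk x choice (suc i) = step (previous x choice i) (walk x choice i) (choice i)
    previous x choice zero    = x
    previous x choice (suc i) = walk x choice i

    module _ {x : Fin N} (K-x : K x ≡ true) where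

      walk-inside : ∀ choice i → K (walk x choice i) ≡ true
      walk-inside choice zero    = K-x
      walk-inside choice (suc i) = step-inside _ (walk-inside choice i) (choice i)

      walk-nonBacktracking : ∀ choice len → NonBacktracking (walk x choice) len
      walk-nonBacktracking choice len = record
        { step      = λ {i} _ → step-adjacent _ (walk-inside choice i) (choice i)
        ; no-return = λ {i} _ → step-no-return _ (walk-inside choice (suc i)) (choice (suc i))
        ; inside    = λ {i} _ → walk-inside choice i
        }

      module _ {choice choice′ : ℕ → Fin m} {d : ℕ} (same : ∀ {j} → j < d → choice j ≡ choice′ j) where

        walk-agree : ∀ {i} → i ≤ d → walk x choice i ≡ walk x choice′ i
        previous-agree : ∀ {i} → i ≤ d → previous x choice i ≡ previous x choice′ i
        walk-agree {zero}  _   = refl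
        walk-agree {suc i} i<d = trans (cong₂ (λ prev cur → step prev cur (choice i)) (previous-agree (<⇒≤ i<d)) (walk-agree (<⇒≤ i<d)))
                                       (cong (step _ _) (same i<d))
        previous-agree {zero}  _   = refl
        previous-agree {suc i} i≤d = walk-agree (<⇒≤ i≤d)

        walk-fork : choice d ≢ choice′ d → walk x choice (suc d) ≢ walk x choice′ (suc d)
        walk-fork differ e = differ (step-injective (previous x choice d) (walk-inside choice d)
          (trans e (sym (cong₂ (λ prev cur → step prev cur (choice′ d)) (previous-agree ≤-refl) (walk-agree ≤-refl)))))

    module _ {C : Set} {M : ℕ} (colour : Fin N → C) (colour-~ : ∀ {u v} → u ~ v → colour u ≡ colour v)
      (place : Fin N → Fin M)
      (place-colour-injective : ∀ {u v} → place u ≡ place v → colour u ≡ colour v → u ≡ v) where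

      walk-colour : ∀ {x} (K-x : K x ≡ true) choice i → colour (walk x choice i) ≡ colour x
      walk-colour K-x choice zero    = refl
      walk-colour K-x choice (suc i) =
        trans (sym (colour-~ (step-adjacent _ (walk-inside K-x choice i) (choice i)))) (walk-colour K-x choice i)

      -- With more walks of length p than places, two of them end at the same vertex.
      short-lollipop : ∀ {x} → K x ≡ true → Fin m → ∀ p → M < m ^ p → ∃ λ L → L < p + p × Lollipop L
      short-lollipop {x} K-x default p M<m^p
        with pigeonhole M<m^p (λ i → place (walk x (sequence default p i) p))
      ... | i , i′ , i<i′ , same-place
        with first-difference default p (λ i≡i′ → <-irrefl (cong toℕ i≡i′) i<i′)
      ... | d , d<p , agree , differ =
        lollipop-from-fork (walk-nonBacktracking K-x X p) (walk-nonBacktracking K-x Y p)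
          (walk-agree K-x agree) (walk-fork K-x agree differ) d<p
          (place-colour-injective same-place (trans (walk-colour K-x X p) (sym (walk-colour K-x Y p))))
        where
        X = sequence default p i
        Y = sequence default p i′

      lollipop-of-length : ∀ {x} → K x ≡ true → ∀ p₁ → M < m ^ suc p₁ → suc p₁ + suc p₁ ≤ suc m →
        Lollipop (suc p₁ + p₁)
      lollipop-of-length K-x p₁ M<m^p 2p≤1+m = stretch (short-lollipop K-x (fromℕ< 0<m) (suc p₁) M<m^p)
        where
        0<m : 0 < m
        0<m = ≤-trans (s≤s z≤n) (≤-trans (m≤n+m (suc p₁) p₁) (≤-pred 2p≤1+m))
        L′≤m : suc p₁ + p₁ ≤ m
        L′≤m = ≤-pred (≤-trans (≤-reflexive (sym (+-suc (suc p₁) p₁))) 2p≤1+m)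
        stretch : (∃ λ L → L < suc p₁ + suc p₁ × Lollipop L) → Lollipop (suc p₁ + p₁)
        stretch (L , L<2p , lollipop) = grow (≤⇒≤′ (≤-pred (≤-trans L<2p (≤-reflexive (+-suc (suc p₁) p₁))))) L′≤m lollipop

-- The disjoint union over all colours k of the bipartite graphs formed by the edges of colour k.
-- A vertex is a colour together with a vertex of K_{n,n} (inj₁ a on the left, inj₂ b on the right).
module ColourGraph {n r : ℕ} (c : Coloring n r) where

  N : ℕ
  N = r * (n + n)

  Side : Set
  Side = Fin n ⊎ Fin n

  colour : Fin N → Fin r
  colour u = proj₁ (remQuot {r} (n + n) u)

  place : Fin N → Fin (n + n)
  place u = proj₂ (remQuot {r} (n + n) u)

  side : Fin N → Side
  side u = splitAt n (place u)

  joins : Fin r → Side → Side → Bool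
  joins k (inj₁ a) (inj₂ b) = ⌊ k ≟ c a b ⌋
  joins k (inj₂ b) (inj₁ a) = ⌊ k ≟ c a b ⌋
  joins k _        _        = false

  adj : Fin N → Fin N → Bool
  adj u v = ⌊ colour v ≟ colour u ⌋ ∧ joins (colour u) (side u) (side v)

  joins-sym : ∀ k s s′ → joins k s s′ ≡ joins k s′ s
  joins-sym k (inj₁ a) (inj₁ b) = refl
  joins-sym k (inj₁ a) (inj₂ b) = refl
  joins-sym k (inj₂ a) (inj₁ b) = refl
  joins-sym k (inj₂ a) (inj₂ b) = refl

  adj-sym : ∀ u v → adj u v ≡ adj v u
  adj-sym u v with colour v ≟ colour u | colour u ≟ colour v
  ... | yes e | yes _ = trans (joins-sym (colour u) (side u) (side v)) (cong (λ k → joins k (side v) (side u)) (sym e))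
  ... | no  _ | no  _ = refl
  ... | yes e | no ne = ⊥-elim (ne (sym e))
  ... | no ne | yes e = ⊥-elim (ne (sym e))

  adj-irrefl : ∀ u → adj u u ≡ false
  adj-irrefl u with colour u ≟ colour u | side u
  ... | no  _ | _      = refl
  ... | yes _ | inj₁ _ = refl
  ... | yes _ | inj₂ _ = refl

  open MinDegree adj adj-sym adj-irrefl

  private
    sum-sides : ∀ (g : Side → ℕ) → sum (λ s → g (splitAt n s)) ≡ sum (g ∘ inj₁) + sum (g ∘ inj₂)
    sum-sides g = trans (sum-++ n (g ∘ splitAt n))
      (cong₂ _+_ (sum-cong-≗ (λ a → cong g (splitAt-↑ˡ n a n))) (sum-cong-≗ (λ b → cong g (splitAt-↑ʳ n n b))))

    sum-vertices : ∀ (f : Fin r → Fin (n + n) → ℕ) → sum (λ u → f (colour u) (place u)) ≡ sum (λ k → sum (f k))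
    sum-vertices f = trans (sum-combine r _)
      (sum-cong-≗ (λ k → sum-cong-≗ (λ s → cong (λ x → f (proj₁ x) (proj₂ x)) (remQuot-combine {r} {n + n} k s))))

    links : Fin r → Side → ℕ
    links k s = sum (λ s′ → 𝟙 (joins k s (splitAt n s′)))

    degree-links : ∀ w → degree (λ _ → true) w ≡ links (colour w) (side w)
    degree-links w = begin
      sum (λ u → 𝟙 (⌊ colour u ≟ colour w ⌋ ∧ joins-w (place u)))
        ≡⟨ sum-vertices (λ k s → 𝟙 (⌊ k ≟ colour w ⌋ ∧ joins-w s)) ⟩
      sum (λ k → sum (λ s → 𝟙 (⌊ k ≟ colour w ⌋ ∧ joins-w s)))
        ≡⟨ sum-cong-≗ (λ k → sum-cong-≗ (λ s → 𝟙-∧ ⌊ k ≟ colour w ⌋ (joins-w s))) ⟩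
      sum (λ k → sum (λ s → if ⌊ k ≟ colour w ⌋ then 𝟙 (joins-w s) else 0))
        ≡⟨ sum-select (colour w) (𝟙 ∘ joins-w) ⟩
      links (colour w) (side w) ∎
      where
      open ≡-Reasoning
      joins-w : Fin (n + n) → Bool
      joins-w s = joins (colour w) (side w) (splitAt n s)
      𝟙-∧ : ∀ b b′ → 𝟙 (b ∧ b′) ≡ (if b then 𝟙 b′ else 0)
      𝟙-∧ true  _ = refl
      𝟙-∧ false _ = refl

    has-colour : Fin r → Fin n → Fin n → ℕ
    has-colour k a b = 𝟙 ⌊ k ≟ c a b ⌋

    links-left : ∀ k a → links k (inj₁ a) ≡ sum (has-colour k a)
    links-left k a = trans (sum-sides (𝟙 ∘ joins k (inj₁ a)))
      (trans (cong (_+ sum (has-colour k a)) (sum-replicate-zero n)) (+-identityˡ _))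

    links-right : ∀ k b → links k (inj₂ b) ≡ sum (λ a → has-colour k a b)
    links-right k b = trans (sum-sides (𝟙 ∘ joins k (inj₂ b)))
      (trans (cong (sum (λ a → has-colour k a b) +_) (sum-replicate-zero n)) (+-identityʳ _))

    each-edge-once : ∀ (h : Fin n → Fin n → Fin r) → sum (λ k → sum (λ x → sum (λ y → 𝟙 ⌊ k ≟ h x y ⌋))) ≡ n * n
    each-edge-once h = begin
      sum (λ k → sum (λ x → sum (λ y → 𝟙 ⌊ k ≟ h x y ⌋))) ≡⟨ ∑-comm (λ k x → sum (λ y → 𝟙 ⌊ k ≟ h x y ⌋)) ⟩
      sum (λ x → sum (λ k → sum (λ y → 𝟙 ⌊ k ≟ h x y ⌋))) ≡⟨ sum-cong-≗ (λ x → ∑-comm (λ k y → 𝟙 ⌊ k ≟ h x y ⌋)) ⟩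
      sum (λ x → sum (λ y → sum (λ k → 𝟙 ⌊ k ≟ h x y ⌋))) ≡⟨ sum-cong-≗ (λ x → sum-cong-≗ (λ y → sum-indicator (h x y) 1)) ⟩
      sum {n} (λ x → sum {n} (λ y → 1))                 ≡⟨ sum-cong-≗ {n} {λ _ → sum {n} (λ _ → 1)} {λ _ → n}
                                                            (λ _ → trans (sum-const n 1) (*-identityʳ n)) ⟩
      sum {n} (λ x → n)                                 ≡⟨ sum-const n n ⟩
      n * n                                             ∎
      where open ≡-Reasoning

  degree-sum-all : degree-sum (λ _ → true) ≡ n * n + n * n
  degree-sum-all = begin
    sum (λ w → degree all w)
      ≡⟨ sum-cong-≗ degree-links ⟩
    sum (λ w → links (colour w) (side w))
      ≡⟨ sum-vertices (λ k s → links k (splitAt n s)) ⟩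
    sum (λ k → sum (λ s → links k (splitAt n s)))
      ≡⟨ sum-cong-≗ (λ k → trans (sum-sides (links k))
           (cong₂ _+_ (sum-cong-≗ (links-left k)) (sum-cong-≗ (links-right k)))) ⟩
    sum (λ k → left k + right k)
      ≡⟨ ∑-distrib-+ left right ⟩
    sum left + sum right
      ≡⟨ cong₂ _+_ (each-edge-once c) (each-edge-once (λ b a → c a b)) ⟩
    n * n + n * n ∎
    where
    open ≡-Reasoning
    all : Fin N → Bool
    all _ = true
    left right : Fin r → ℕ
    left  k = sum (λ a → sum (λ b → has-colour k a b))
    right k = sum (λ b → sum (λ a → has-colour k a b))

  name : Side → Fin n
  name (inj₁ a) = a
  name (inj₂ b) = b

  left? : Side → Bool
  left? (inj₁ _) = true
  left? (inj₂ _) = false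

  -- Junk unless the two sides are opposite.
  between : Side → Side → Fin r
  between (inj₁ a) s = c a (name s)
  between (inj₂ b) s = c (name s) b

  private
    ≟-true : ∀ {k l : Fin r} → ⌊ k ≟ l ⌋ ≡ true → k ≡ l
    ≟-true {k} {l} e with k ≟ l
    ... | yes k≡l = k≡l

    joins-between : ∀ {k} s s′ → joins k s s′ ≡ true → between s s′ ≡ k
    joins-between (inj₁ a) (inj₂ b) e = sym (≟-true e)
    joins-between (inj₂ b) (inj₁ a) e = sym (≟-true e)

    joins-opposite : ∀ {k} s s′ → joins k s s′ ≡ true → left? s′ ≡ not (left? s)
    joins-opposite (inj₁ a) (inj₂ b) _ = refl
    joins-opposite (inj₂ b) (inj₁ a) _ = refl

    side-injective : ∀ {s s′} → left? s ≡ left? s′ → name s ≡ name s′ → s ≡ s′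
    side-injective {inj₁ a} {inj₁ a′} _ refl = refl
    side-injective {inj₂ b} {inj₂ b′} _ refl = refl

  module _ {u v : Fin N} (u~v : adj u v ≡ true) where

    adjacent-colour : colour u ≡ colour v
    adjacent-colour = sym (≟-true (proj₁ (∧-true u~v)))

    adjacent-between : between (side u) (side v) ≡ colour u
    adjacent-between = joins-between (side u) (side v) (proj₂ (∧-true u~v))

    adjacent-opposite : left? (side v) ≡ not (left? (side u))
    adjacent-opposite = joins-opposite (side u) (side v) (proj₂ (∧-true u~v))

  place-colour-injective : ∀ {u v} → place u ≡ place v → colour u ≡ colour v → u ≡ v
  place-colour-injective {u} {v} same-place same-colour =
    trans (sym (combine-remQuot {r} (n + n) u)) (trans (cong₂ combine same-colour same-place) (combine-remQuot {r} (n + n) v))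

  vertex-injective : ∀ {u v} → left? (side u) ≡ left? (side v) → name (side u) ≡ name (side v) → colour u ≡ colour v → u ≡ v
  vertex-injective {u} {v} same-left same-name = place-colour-injective
    (trans (sym (join-splitAt n n (place u)))
      (trans (cong (join n n) (side-injective same-left same-name)) (join-splitAt n n (place v))))

  between-left : ∀ s s′ → left? s ≡ true → between s s′ ≡ c (name s) (name s′)
  between-left (inj₁ a) s′ _ = refl

  between-right : ∀ s s′ → left? s ≡ false → between s s′ ≡ c (name s′) (name s)
  between-right (inj₂ b) s′ _ = refl

  -- Along a lollipop with 2p vertices, even vertices X i and odd vertices Y j lie on opposite
  -- sides; they span a copy of K_{p,p} in which the path and the chord give 2p edges of one colour.
  module FromLollipop (p₂ : ℕ) {K : Fin N → Bool}
    (lollipop : Walks.Lollipop adj adj-sym adj-irrefl K (suc (suc p₂) + suc p₂)) where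

    open Walks adj adj-sym adj-irrefl K using (~-sym)
    open Walks.Lollipop lollipop renaming (vertex to z)

    p₁ p L : ℕ
    p₁ = suc p₂
    p  = suc p₁
    L  = p + p₁

    left-z : ℕ → Bool
    left-z i = left? (side (z i))

    b₀ : Bool
    b₀ = left-z 0

    colour-z : ∀ {i} → i ≤ L → colour (z i) ≡ colour (z 0)
    colour-z {zero}  _     = refl
    colour-z {suc i} i<L = trans (sym (adjacent-colour (path i<L))) (colour-z (<⇒≤ i<L))

    even-side : ∀ s → s + s ≤ L → left-z (s + s) ≡ b₀
    even-side zero    _ = refl
    even-side (suc s) 2s+2≤L = begin
      left-z (suc s + suc s)         ≡⟨ cong left-z (cong suc (+-suc s s)) ⟩
      left-z (suc (suc (s + s)))     ≡⟨ adjacent-opposite (path 2s+2≤L′) ⟩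
      not (left-z (suc (s + s)))     ≡⟨ cong not (adjacent-opposite (path (<-trans (n<1+n (s + s)) 2s+2≤L′))) ⟩
      not (not (left-z (s + s)))     ≡⟨ not-involutive _ ⟩
      left-z (s + s)                 ≡⟨ even-side s (≤-trans (n≤1+n (s + s)) (<⇒≤ 2s+2≤L′)) ⟩
      b₀                             ∎
      where
      open ≡-Reasoning
      2s+2≤L′ : suc (s + s) < L
      2s+2≤L′ = subst (_≤ L) (cong suc (+-suc s s)) 2s+2≤L

    odd-side : ∀ s → suc (s + s) ≤ L → left-z (suc (s + s)) ≡ not b₀
    odd-side s 2s+1≤L = trans (adjacent-opposite (path 2s+1≤L)) (cong not (even-side s (<⇒≤ 2s+1≤L)))

    private
      even-or-odd : ∀ a → ∃ λ t → a ≡ t + t ⊎ a ≡ suc (t + t)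
      even-or-odd zero    = 0 , inj₁ refl
      even-or-odd (suc a) with even-or-odd a
      ... | t , inj₁ a≡2t   = t , inj₂ (cong suc a≡2t)
      ... | t , inj₂ a≡2t+1 = suc t , inj₁ (trans (cong suc a≡2t+1) (cong suc (sym (+-suc t t))))

      double-injective : ∀ {s t} → s + s ≡ t + t → s ≡ t
      double-injective {zero}  {zero}  _ = refl
      double-injective {suc s} {suc t} e =
        cong suc (double-injective (cong pred (trans (sym (+-suc s s)) (trans (cong pred e) (+-suc t t)))))

    -- The chord ends at the odd vertex z L, so it starts at an even vertex.
    anchor-even : ∃ λ t → anchor ≡ t + t
    anchor-even with even-or-odd anchor
    ... | t , inj₁ a≡2t   = t , a≡2t
    ... | t , inj₂ a≡2t+1 = ⊥-elim (not-¬ refl (begin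
      b₀                     ≡⟨ sym (not-involutive b₀) ⟩
      not (not b₀)           ≡⟨ cong not (sym (odd-side p₁ ≤-refl)) ⟩
      not (left-z L)         ≡⟨ sym (adjacent-opposite chord) ⟩
      left-z anchor          ≡⟨ cong left-z a≡2t+1 ⟩
      left-z (suc (t + t))   ≡⟨ odd-side t (subst (_≤ L) a≡2t+1 (≤-trans (n≤1+n _) (<⇒≤ anchor+2≤L))) ⟩
      not b₀                 ∎))
      where open ≡-Reasoning

    t : ℕ
    t = proj₁ anchor-even

    t<p₁ : t < p₁
    t<p₁ = ≰⇒> λ p₁≤t → <⇒≱ 2t<2p₁ (+-mono-≤ p₁≤t p₁≤t)
      where
      2t<2p₁ : t + t < p₁ + p₁
      2t<2p₁ = ≤-pred (subst (λ a → 2 + a ≤ L) (proj₂ anchor-even) anchor+2≤L)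

    X Y : Fin p → Fin N
    X i = z (toℕ i + toℕ i)
    Y i = z (suc (toℕ i + toℕ i))

    private
      Y-bound : ∀ (i : Fin p) → suc (toℕ i + toℕ i) ≤ L
      Y-bound i = s≤s (+-mono-≤ {toℕ i} {p₁} (≤-pred (toℕ<n i)) (≤-pred (toℕ<n i)))

      X-bound : ∀ (i : Fin p) → toℕ i + toℕ i ≤ L
      X-bound i = <⇒≤ (Y-bound i)

      X-left : ∀ i → left? (side (X i)) ≡ b₀
      X-left i = even-side (toℕ i) (X-bound i)

      Y-left : ∀ i → left? (side (Y i)) ≡ not b₀
      Y-left i = odd-side (toℕ i) (Y-bound i)

    X~Y : ∀ (i : Fin p) → adj (X i) (Y i) ≡ true
    X~Y i = path (Y-bound i)

    X-suc~Y : ∀ (j : Fin p₁) → adj (X (suc j)) (Y (inject₁ j)) ≡ true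
    X-suc~Y j = ~-sym (subst₂ (λ u v → adj u v ≡ true)
      (cong (λ i → z (suc (i + i))) (sym (toℕ-inject₁ j)))
      (cong z (cong suc (sym (+-suc (toℕ j) (toℕ j)))))
      (path (s≤s (+-mono-≤ (toℕ<n j) (<⇒≤ (toℕ<n j))))))

    X-anchor~Y-last : adj (X (inject₁ (fromℕ< t<p₁))) (Y (fromℕ p₁)) ≡ true
    X-anchor~Y-last = ~-sym (subst₂ (λ u v → adj u v ≡ true)
      (cong (λ i → z (suc (i + i))) (sym (toℕ-fromℕ p₁)))
      (trans (cong z (proj₂ anchor-even)) (cong (λ i → z (i + i)) (sym (trans (toℕ-inject₁ _) (toℕ-fromℕ< t<p₁)))))
      chord)

    private
      X-name-injective : Injective _≡_ _≡_ (name ∘ side ∘ X)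
      X-name-injective {i} {j} e = toℕ-injective (double-injective (distinct (X-bound i) (X-bound j)
        (vertex-injective (trans (X-left i) (sym (X-left j))) e
          (trans (colour-z (X-bound i)) (sym (colour-z (X-bound j)))))))

      Y-name-injective : Injective _≡_ _≡_ (name ∘ side ∘ Y)
      Y-name-injective {i} {j} e = toℕ-injective (double-injective (cong pred (distinct (Y-bound i) (Y-bound j)
        (vertex-injective (trans (Y-left i) (sym (Y-left j))) e
          (trans (colour-z (Y-bound i)) (sym (colour-z (Y-bound j))))))))

      κ : Fin p × Fin p → Fin r
      κ (i , j) = between (side (X i)) (side (Y j))

      few-colours : (g : Fin (p * p ∸ 2 * p + 2) → Fin p × Fin p) → ¬ Injective _≡_ _≡_ (κ ∘ g)
      few-colours = path-and-chord-monochromatic⇒few-colours p₂ κ (colour (z 0)) (fromℕ< t<p₁)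
        (λ j → trans (adjacent-between (X~Y j)) (colour-z (X-bound j)))
        (λ j → trans (adjacent-between (X-suc~Y j)) (colour-z (X-bound (suc j))))
        (trans (adjacent-between X-anchor~Y-last) (colour-z (X-bound (inject₁ (fromℕ< t<p₁)))))

    ¬coloring : ¬ IsKppqColoring p (p * p ∸ 2 * p + 2) c
    ¬coloring coloring with b₀ in b₀≡
    ... | true =
      let g , g-inj = coloring (name ∘ side ∘ X) (name ∘ side ∘ Y) X-name-injective Y-name-injective
      in few-colours g (injective-≗ (λ k → between-left _ _ (trans (X-left (proj₁ (g k))) b₀≡)) g-inj)
    ... | false =
      let g , g-inj = coloring (name ∘ side ∘ Y) (name ∘ side ∘ X) Y-name-injective X-name-injective
      in few-colours (swap ∘ g) (injective-≗ (λ k → between-right _ _ (trans (X-left (proj₂ (g k))) b₀≡)) g-inj)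

module _ {n r : ℕ} (c : Coloring n r) (p₂ m : ℕ) where
  private
    p : ℕ
    p = suc (suc p₂)
  open ColourGraph c

  open MinDegree adj adj-sym adj-irrefl

  module _ {K : Fin N → Bool} (min-degree : HasMinDegree (suc m) K) where
    open Walks adj adj-sym adj-irrefl K

    private
      neighbours : ∀ v → K v ≡ true →
        Σ (Fin (suc m) → Fin N) λ h → Injective _≡_ _≡_ h × (∀ i → K (h i) ∧ adj v (h i) ≡ true)
      neighbours v K-v = ≤count⇒injection (λ u → K u ∧ adj v u) (suc m) (min-degree v K-v)

      -- K v ≡ true is kept as an equation so that the neighbours chosen at v can use it
      choose : ∀ v b → K v ≡ b → Fin (suc m) → Fin N
      choose v true  K-v = proj₁ (neighbours v K-v)
      choose v false _   = λ _ → v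

      nbr : Fin N → Fin (suc m) → Fin N
      nbr v = choose v (K v) refl

      nbr-spec : ∀ {v} → K v ≡ true → Injective _≡_ _≡_ (nbr v) × (∀ i → K (nbr v i) ∧ adj v (nbr v i) ≡ true)
      nbr-spec {v} = spec (K v) refl
        where
        spec : ∀ b (e : K v ≡ b) → K v ≡ true →
          Injective _≡_ _≡_ (choose v b e) × (∀ i → K (choose v b e i) ∧ adj v (choose v b e i) ≡ true)
        spec true  e _   = proj₂ (neighbours v e)
        spec false e K-v with trans (sym e) K-v
        ... | ()

    lollipop-in-subgraph : ∀ {x} → K x ≡ true → n + n < m ^ p → p + p ≤ suc m → Lollipop (p + suc p₂)
    lollipop-in-subgraph K-x =
      lollipop-of-length nbr (proj₁ ∘ nbr-spec)
        (λ i K-v → proj₁ (∧-true {K (nbr _ i)} (proj₂ (nbr-spec K-v) i)))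
        (λ i K-v → proj₂ (∧-true {K (nbr _ i)} (proj₂ (nbr-spec K-v) i)))
        colour adjacent-colour place place-colour-injective K-x (suc p₂)

  walk-count-bound : IsKppqColoring p (p * p ∸ 2 * p + 2) c →
    2 * (suc m * (r * (n + n))) < n * n + n * n → p + p ≤ suc m → m ^ p ≤ n + n
  walk-count-bound coloring dense 2p≤1+m with min-degree-subgraph (suc m) everything dense′
    where
    everything : Fin N → Bool
    everything _ = true
    dense′ : 2 * (suc m * count everything) < degree-sum everything
    dense′ = subst₂ (λ s d → 2 * (suc m * s) < d) (sym (trans (sum-const N 1) (*-identityʳ N))) (sym degree-sum-all) dense
  ... | K , (x , K-x) , min-degree = ≮⇒≥ λ 2n<m^p →
    FromLollipop.¬coloring p₂ (lollipop-in-subgraph min-degree K-x 2n<m^p 2p≤1+m) coloring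

^-distribʳ-* : ∀ a b k → (a * b) ^ k ≡ a ^ k * b ^ k
^-distribʳ-* a b zero    = refl
^-distribʳ-* a b (suc k) = trans (cong (a * b *_) (^-distribʳ-* a b k)) (interchange a b (a ^ k) (b ^ k))
  where
  interchange : ∀ a b x y → a * b * (x * y) ≡ a * x * (b * y)
  interchange = solve-∀

division-bounds : ∀ m D .{{_ : NonZero D}} → ∃ λ δ → δ * D ≤ m × m < suc δ * D
division-bounds m D = m / D , m/n*n≤m m D ,
  subst (_< suc (m / D) * D) (sym (m≡m%n+[m/n]*n m D)) (+-monoˡ-< ((m / D) * D) (m%n<n m D))

n≤B⇒n^k≤B^[1+k] : ∀ n k B → 1 ≤ n → n ≤ B → n ^ k ≤ B ^ suc k
n≤B⇒n^k≤B^[1+k] n k B 1≤n n≤B = ≤-trans (m≤n*m (n ^ k) n {{>-nonZero 1≤n}}) (^-monoˡ-≤ (suc k) n≤B)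

n≤mR⇒m^[1+k]≤2n⇒n^k≤2R^[1+k] : ∀ n′ k m R → suc n′ ≤ m * R → m ^ suc k ≤ suc n′ + suc n′ →
  suc n′ ^ k ≤ 2 * R ^ suc k
n≤mR⇒m^[1+k]≤2n⇒n^k≤2R^[1+k] n′ k m R n≤mR m^[1+k]≤2n = *-cancelˡ-≤ n (begin
  n * n ^ k                   ≤⟨ ^-monoˡ-≤ (suc k) n≤mR ⟩
  (m * R) ^ suc k             ≡⟨ ^-distribʳ-* m R (suc k) ⟩
  m ^ suc k * R ^ suc k       ≤⟨ *-monoˡ-≤ (R ^ suc k) m^[1+k]≤2n ⟩
  (n + n) * R ^ suc k         ≡⟨ double-* n (R ^ suc k) ⟩
  n * (2 * R ^ suc k)         ∎)
  where
  open ≤-Reasoning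
  n = suc n′
  double-* : ∀ n x → (n + n) * x ≡ n * (2 * x)
  double-* = solve-∀

-- With δ = ⌊(n - 1) / 2r⌋ the colour graph, with 2n vertices per colour and n² edges, has average
-- degree above 2δ.
dense-colour-graph : ∀ n′ r δ → δ * (2 * r) ≤ n′ →
  2 * (δ * (r * (suc n′ + suc n′))) < suc n′ * suc n′ + suc n′ * suc n′
dense-colour-graph n′ r δ δD≤n′ = begin-strict
  2 * (δ * (r * (n + n)))   ≡⟨ regroup δ r n ⟩
  δ * (2 * r) * (n + n)     ≤⟨ *-monoˡ-≤ (n + n) δD≤n′ ⟩
  n′ * (n + n)              <⟨ m<m+n (n′ * (n + n)) (s≤s z≤n) ⟩
  n′ * (n + n) + (n + n)    ≡⟨ expand n′ ⟩
  n * n + n * n             ∎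
  where
  open ≤-Reasoning
  n = suc n′
  regroup : ∀ δ r n → 2 * (δ * (r * (n + n))) ≡ δ * (2 * r) * (n + n)
  regroup = solve-∀
  expand : ∀ n′ → n′ * (suc n′ + suc n′) + (suc n′ + suc n′) ≡ suc n′ * suc n′ + suc n′ * suc n′
  expand = solve-∀

module _ (p₂ n′ r′ : ℕ) where
  private
    p n r D : ℕ
    p = suc (suc p₂)
    n = suc n′
    r = suc r′
    D = 2 * r

    small-degree : ∀ δ → n ≤ suc δ * D → δ < p + p → n ≤ 8 * p * r
    small-degree δ n≤[1+δ]D δ<2p = begin
      n             ≤⟨ n≤[1+δ]D ⟩
      suc δ * D     ≤⟨ *-monoˡ-≤ D δ<2p ⟩
      (p + p) * D   ≡⟨ four p r ⟩
      4 * p * r     ≤⟨ *-monoˡ-≤ r (*-monoˡ-≤ p {4} {8} (s≤s (s≤s (s≤s (s≤s z≤n))))) ⟩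
      8 * p * r     ∎
      where
      open ≤-Reasoning
      four : ∀ p r → (p + p) * (2 * r) ≡ 4 * p * r
      four = solve-∀

    large-degree : ∀ m → n ≤ suc (suc m) * D → p + p ≤ suc m → n ≤ m * (2 * D)
    large-degree m n≤[2+m]D 2p≤1+m =
      ≤-trans n≤[2+m]D (≤-trans (*-monoˡ-≤ D (+-mono-≤ {2} {m} 2≤m ≤-refl)) (≤-reflexive (twice m D)))
      where
      2≤m : 2 ≤ m
      2≤m = ≤-pred (≤-trans (s≤s (s≤s (≤-trans (s≤s z≤n) (m≤n+m (suc (suc p₂)) p₂)))) 2p≤1+m)
      twice : ∀ m D → (m + m) * D ≡ m * (2 * D)
      twice = solve-∀

    2[2D]^p≤[8pr]^p : 2 * (2 * D) ^ p ≤ (8 * p * r) ^ p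
    2[2D]^p≤[8pr]^p = begin
      2 * (2 * D) ^ p        ≤⟨ *-monoˡ-≤ ((2 * D) ^ p) (^-monoʳ-≤ 2 {1} {p} (s≤s z≤n)) ⟩
      2 ^ p * (2 * D) ^ p    ≡⟨ sym (^-distribʳ-* 2 (2 * D) p) ⟩
      (2 * (2 * D)) ^ p      ≤⟨ ^-monoˡ-≤ p (≤-trans (≤-reflexive (eight r)) (*-monoˡ-≤ r (*-monoʳ-≤ 8 {1} {p} (s≤s z≤n)))) ⟩
      (8 * p * r) ^ p        ∎
      where
      open ≤-Reasoning
      eight : ∀ r → 2 * (2 * (2 * r)) ≡ 8 * 1 * r
      eight = solve-∀

  -- Either δ < 2p and n = O(r), or the walks bound m ^ p ≤ 2n with n ≤ 4 m r applies.
  colouring-bound : (c : Coloring n r) → IsKppqColoring p (p * p ∸ 2 * p + 2) c → n ^ suc p₂ ≤ (8 * p * r) ^ p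
  colouring-bound c coloring with division-bounds n′ D
  ... | δ , δD≤n′ , n≤[1+δ]D with p + p ≤? δ
  ...   | no 2p≰δ = n≤B⇒n^k≤B^[1+k] n (suc p₂) (8 * p * r) (s≤s z≤n) (small-degree δ n≤[1+δ]D (≰⇒> 2p≰δ))
  ...   | yes 2p≤δ with δ
  ...     | suc m = ≤-trans
    (n≤mR⇒m^[1+k]≤2n⇒n^k≤2R^[1+k] n′ (suc p₂) m (2 * D) (large-degree m n≤[1+δ]D 2p≤δ)
      (walk-count-bound c p₂ m coloring (dense-colour-graph n′ r (suc m) δD≤n′) 2p≤δ))
    2[2D]^p≤[8pr]^p

theorem1p11 : (p : ℕ) → 2 ≤ p →
    ∃[ d ] ∃[ N ] ((n r : ℕ) → N ≤ n → IsR n p (p * p ∸ 2 * p + 2) r →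
    n ^ (p ∸ 1) ≤ (d * r) ^ p)
theorem1p11 p@(suc (suc p₂)) (s≤s (s≤s z≤n)) = 8 * p , 1 , bound
  where
  bound : (n r : ℕ) → 1 ≤ n → IsR n p (p * p ∸ 2 * p + 2) r → n ^ (p ∸ 1) ≤ (8 * p * r) ^ p
  bound (suc n′) zero     _ ((c , _) , _) with c zero zero
  ... | ()
  bound (suc n′) (suc r′) _ ((c , coloring) , _) = colouring-bound p₂ n′ r′ c coloring
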